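{- Let $G=(V,E)$ be a fork-free graph and $I,J$ independent sets of $G$ of the same size, such that no vertex of $G$ is adjacent to three or more vertices of $I$. Let $M$ be a non-trivial module of $G$ with $M\cap I=\{u\}$ and $M\cap J=\{v\}$, where $u$ and $v$ lie in distinct connected components of $G[M]$. If there is a vertex $c\in V\setminus M$ with $N(c)\cap I=\{u\}$, then $I\leftrightsquigarrow J$ in $G$ if and only if $I_M\leftrightsquigarrow J_M$ in $G_M$. If there is no such vertex $c$, then there is no TS-reconfiguration sequence from $I$ to $J$ in $G$.
   Context: A module is a set $M\subseteq V$ such that each vertex outside $M$ is adjacent to all or none of $M$; non-trivial means $M\ne\emptyset$, $M\neq V$. A fork is the claw with one edge subdivided once. Two independent sets $A,B$ are TS-adjacent if $A\setminus B=\{x\}$, $B\setminus A=\{y\}$ and $xy\in E$; $A\leftrightsquigarrow B$ means there is a TS-reconfiguration sequence (a sequence of independent sets with consecutive sets TS-adjacent) from $A$ to $B$. For a module $M$ with $|M\cap I|\le 1$ and $|M\cap J|\le1$, $G_M$ is the graph obtained from $G$ by replacing $M$ with a single new vertex $m$ adjacent to exactly the vertices of $V\setminus M$ adjacent to $M$; $I_M=(I\setminus M)\cup\{m\}$ if $|I\cap M|=1$ and $I_M=I\setminus M$ otherwise, and similarly for $J_M$. -}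

module Defs where

open import Data.Bool using (Bool; true; false; T; not; _∧_)
open import Data.Maybe using (Maybe; just; nothing)
open import Data.Product using (Σ; Σ-syntax; ∃; ∃-syntax; _×_; _,_)
open import Data.Sum using (_⊎_)
open import Data.Empty using (⊥)
open import Data.Nat using (ℕ)
open import Data.Fin using (Fin)
open import Relation.Nullary using (¬_)
open import Relation.Binary.PropositionalEquality using (_≡_; _≢_)
open import Relation.Binary.Construct.Closure.ReflexiveTransitive using (Star)
open import Function.Bundles using (_↔_)

record Graph : Set₁ where
  field
    V      : Set
    _~_    : V → V → Set
    ~-sym  : ∀ {x y} → x ~ y → y ~ x
    ~-irr  : ∀ {x} → ¬ (x ~ x)

open Graph public

Finite : Graph → Set
Finite G = Σ[ n ∈ ℕ ] (V G ↔ Fin n)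

VSet : Set → Set
VSet A = A → Bool

_∈_ : {A : Set} → A → VSet A → Set
x ∈ S = T (S x)

_∉_ : {A : Set} → A → VSet A → Set
x ∉ S = ¬ (x ∈ S)

HasSize : {A : Set} → VSet A → ℕ → Set
HasSize {A} S k = (Σ A (λ x → x ∈ S)) ↔ Fin k

SameSize : {A : Set} → VSet A → VSet A → Set
SameSize S S' = Σ[ k ∈ ℕ ] (HasSize S k × HasSize S' k)

-- S = {u} (for S given as an intersection / difference we write it out)
IsSingleton : {A : Set} → (A → Set) → A → Set
IsSingleton P u = P u × (∀ z → P z → z ≡ u)

module _ (G : Graph) where
  private
    X = V G
    _≈_ = _~_ G

  Independent : VSet X → Set
  Independent S = ∀ x y → x ∈ S → y ∈ S → ¬ (x ≈ y)

  IsFork : X → X → X → X → X → Set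
  IsFork a b c d e =
    (a ≢ b × a ≢ c × a ≢ d × a ≢ e × b ≢ c × b ≢ d × b ≢ e × c ≢ d × c ≢ e × d ≢ e)
    × (a ≈ b × a ≈ c × a ≈ d × d ≈ e)
    × (¬ (b ≈ c) × ¬ (b ≈ d) × ¬ (c ≈ d) × ¬ (a ≈ e) × ¬ (b ≈ e) × ¬ (c ≈ e))

  ForkFree : Set
  ForkFree = ∀ a b c d e → ¬ IsFork a b c d e

  NoVertexSeesThree : VSet X → Set
  NoVertexSeesThree S =
    ∀ w x y z → x ∈ S → y ∈ S → z ∈ S → x ≢ y → x ≢ z → y ≢ z →
      ¬ (w ≈ x × w ≈ y × w ≈ z)

  IsModule : VSet X → Set
  IsModule M = ∀ z → z ∉ M → (∀ x → x ∈ M → z ≈ x) ⊎ (∀ x → x ∈ M → ¬ (z ≈ x))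

  NonTrivial : VSet X → Set
  NonTrivial M = (Σ[ x ∈ X ] x ∈ M) × (Σ[ y ∈ X ] y ∉ M)

  ConnectedIn : VSet X → X → X → Set
  ConnectedIn M = Star (λ a b → a ∈ M × b ∈ M × a ≈ b)

  TSAdj : VSet X → VSet X → Set
  TSAdj A B = Independent A × Independent B ×
    Σ[ x ∈ X ] Σ[ y ∈ X ]
      ( IsSingleton (λ z → z ∈ A × z ∉ B) x
      × IsSingleton (λ z → z ∈ B × z ∉ A) y
      × x ≈ y )

  TSReach : VSet X → VSet X → Set
  TSReach = Star TSAdj

-- Contraction of a module M to a single vertex m (represented by nothing).

module _ (G : Graph) (M : VSet (V G)) where
  private
    X = V G
    _≈_ = _~_ G

  VM : Set
  VM = Maybe (Σ[ x ∈ X ] T (not (M x)))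

  private
    adj : VM → VM → Set
    adj nothing  nothing  = ⊥
    adj nothing  (just (y , _)) = Σ[ z ∈ X ] (z ∈ M × z ≈ y)
    adj (just (x , _)) nothing  = Σ[ z ∈ X ] (z ∈ M × x ≈ z)
    adj (just (x , _)) (just (y , _)) = x ≈ y

    adj-sym : ∀ {a b} → adj a b → adj b a
    adj-sym {nothing} {just _} (z , zM , zy) = z , zM , ~-sym G zy
    adj-sym {just _} {nothing} (z , zM , xz) = z , zM , ~-sym G xz
    adj-sym {just _} {just _} e = ~-sym G e

    adj-irr : ∀ {a} → ¬ adj a a
    adj-irr {nothing} ()
    adj-irr {just _} e = ~-irr G e

  contract : Graph
  contract = record { V = VM ; _~_ = adj ; ~-sym = λ {a} {b} → adj-sym {a} {b} ; ~-irr = λ {a} → adj-irr {a} }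

  -- S_M, where the flag says whether |S ∩ M| = 1 (then m ∈ S_M) or not.
  contractSet : Bool → VSet X → VSet VM
  contractSet b S nothing        = b
  contractSet b S (just (x , _)) = S x

{-# OPTIONS --safe #-}
-- A move of G either stays inside the module M, where it is invisible in G/M, or is
-- a move of G/M; hence I ⇝ J in G gives I_M ⇝ J_M.  Conversely G/M is the subgraph of
-- G induced by (V ∖ M) ∪ {v}, so I_M ⇝ J_M lifts to a sequence from (I ∖ {u}) ∪ {v}
-- to J, and that set is reached from I by moving the token of u to c and then to v.
-- Without such a c, every neighbour outside M of the token a ∈ M has a neighbour in
-- S ∖ M, S the current set.  Fork-freeness, with v as a third leaf,
-- keeps this true under moves outside M, so a can never leave M; it only moves
-- inside the component of u in G[M] and never reaches v.
module Submission where

open import Defs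
open import Data.Bool using (Bool; true; false; T; not; _∧_; _∨_)
open import Data.Bool.Properties using (T?; T-∧; T-∨; T-irrelevant)
open import Data.Maybe using (just; nothing)
open import Data.Product using (Σ-syntax; _×_; _,_; proj₁; proj₂)
open import Data.Sum using (_⊎_; inj₁; inj₂)
open import Data.Empty using (⊥; ⊥-elim)
open import Data.Unit using (tt)
open import Function using (_∘_)
open import Data.Fin.Properties using (inj⇒≟)
open import Function.Bundles using (_⇔_; mk⇔; Equivalence)
open import Function.Properties.Inverse using (↔⇒↣)
open import Relation.Nullary using (¬_; yes; no)
open import Relation.Nullary.Decidable
  using (⌊_⌋; _×-dec_; decidable-stable; toWitness; fromWitness; toWitnessFalse; fromWitnessFalse)
open import Relation.Binary.Definitions using (DecidableEquality)
open import Relation.Binary.PropositionalEquality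
  using (_≡_; _≢_; refl; sym; trans; cong; subst; subst₂; _≗_; ≢-sym)
open import Relation.Binary.Construct.Closure.ReflexiveTransitive using (ε; _◅_; _◅◅_; gmap)

open Equivalence using (to; from)

T-not⁺ : ∀ {b} → ¬ T b → T (not b)
T-not⁺ {false} _ = tt
T-not⁺ {true} ¬b = ¬b tt

T-not⁻ : ∀ {b} → T (not b) → ¬ T b
T-not⁻ {false} _ ()

T-injective : ∀ {a b} → (T a → T b) → (T b → T a) → a ≡ b
T-injective {false} {false} _ _ = refl
T-injective {false} {true} _ b⇒a = ⊥-elim (b⇒a tt)
T-injective {true} {false} a⇒b _ = ⊥-elim (a⇒b tt)
T-injective {true} {true} _ _ = refl

module Forks (H : Graph) where
  private
    _≈_ = _~_ H

  ≈⇒≢ : ∀ {x y} → x ≈ y → x ≢ y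
  ≈⇒≢ xy refl = ~-irr H xy

  distinguish : ∀ {x y z} → ¬ x ≈ z → y ≈ z → x ≢ y
  distinguish ¬xz yz refl = ¬xz yz

  -- Of the ten distinctness conditions of a fork only b ≢ c does not follow from the adjacencies.
  no-fork : ForkFree H → ∀ {a b c d e} → b ≢ c →
    a ≈ b → a ≈ c → a ≈ d → d ≈ e →
    ¬ b ≈ c → ¬ b ≈ d → ¬ c ≈ d → ¬ a ≈ e → ¬ b ≈ e → ¬ c ≈ e → ⊥
  no-fork forkFree {a} {b} {c} {d} {e} b≢c ab ac ad de ¬bc ¬bd ¬cd ¬ae ¬be ¬ce =
    forkFree a b c d e
      ( ( ≈⇒≢ ab , ≈⇒≢ ac , ≈⇒≢ ad , ≢-sym (distinguish (¬be ∘ ~-sym H) ab)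
        , b≢c , distinguish ¬be de , ≢-sym (distinguish (¬ae ∘ ~-sym H) (~-sym H ab))
        , distinguish ¬ce de , ≢-sym (distinguish (¬ae ∘ ~-sym H) (~-sym H ac)) , ≈⇒≢ de )
      , (ab , ac , ad , de)
      , (¬bc , ¬bd , ¬cd , ¬ae , ¬be , ¬ce) )

module TokenSliding (H : Graph) where
  private
    X = V H
    _≈_ = _~_ H

  module _ {A B : VSet X} (s : TSAdj H A B) where
    src : X
    src = proj₁ (proj₂ (proj₂ s))

    dst : X
    dst = proj₁ (proj₂ (proj₂ (proj₂ s)))

    src∈ : src ∈ A
    src∈ = proj₁ (proj₁ (proj₁ (proj₂ (proj₂ (proj₂ (proj₂ s))))))

    src∉ : src ∉ B
    src∉ = proj₂ (proj₁ (proj₁ (proj₂ (proj₂ (proj₂ (proj₂ s))))))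

    only-src : ∀ z → z ∈ A × z ∉ B → z ≡ src
    only-src = proj₂ (proj₁ (proj₂ (proj₂ (proj₂ (proj₂ s)))))

    src~dst : src ≈ dst
    src~dst = proj₂ (proj₂ (proj₂ (proj₂ (proj₂ (proj₂ s)))))

    kept : ∀ {z} → z ∈ A → z ≢ src → z ∈ B
    kept {z} z∈A z≢src with T? (B z)
    ... | yes z∈B = z∈B
    ... | no z∉B = ⊥-elim (z≢src (only-src z (z∈A , z∉B)))

  TSAdj-sym : ∀ {A B} → TSAdj H A B → TSAdj H B A
  TSAdj-sym (iA , iB , x , y , leave , enter , xy) = iB , iA , y , x , enter , leave , ~-sym H xy

  dst∈ : ∀ {A B} (s : TSAdj H A B) → dst s ∈ B
  dst∈ s = src∈ (TSAdj-sym s)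

  src≢dst : ∀ {A B} (s : TSAdj H A B) → src s ≢ dst s
  src≢dst {A} s src≡dst = src∉ (TSAdj-sym s) (subst (_∈ A) src≡dst (src∈ s))

  TSAdj-agree : ∀ {A B} (s : TSAdj H A B) {z} → z ≢ src s → z ≢ dst s → A z ≡ B z
  TSAdj-agree s z≢src z≢dst = T-injective (λ z∈ → kept s z∈ z≢src) (λ z∈ → kept (TSAdj-sym s) z∈ z≢dst)

  TSAdj-respˡ : ∀ {A A' B} → A ≗ A' → TSAdj H A B → TSAdj H A' B
  TSAdj-respˡ {A} {A'} {B} A≗A' (iA , iB , x , y , ((x∈ , x∉) , only-x) , ((y∈ , y∉) , only-y) , xy) =
    iA' , iB , x , y
    , ((∈A' x∈ , x∉) , λ z (z∈ , z∉) → only-x z (∈A z∈ , z∉))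
    , ((y∈ , y∉ ∘ ∈A) , λ z (z∈ , z∉) → only-y z (z∈ , z∉ ∘ ∈A'))
    , xy
    where
    ∈A' : ∀ {z} → z ∈ A → z ∈ A'
    ∈A' {z} = subst T (A≗A' z)
    ∈A : ∀ {z} → z ∈ A' → z ∈ A
    ∈A {z} = subst T (sym (A≗A' z))
    iA' : Independent H A'
    iA' x y x∈ y∈ = iA x y (∈A x∈) (∈A y∈)

  TSAdj-respʳ : ∀ {A B B'} → B ≗ B' → TSAdj H A B → TSAdj H A B'
  TSAdj-respʳ B≗B' = TSAdj-sym ∘ TSAdj-respˡ B≗B' ∘ TSAdj-sym

  -- Without function extensionality pointwise equal sets need not be equal, so paths
  -- are first built up to _≗_ at the target.
  TSReach≗ : VSet X → VSet X → Set
  TSReach≗ A B = Σ[ B' ∈ VSet X ] TSReach H A B' × B' ≗ B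

  infixr 5 _◅≗_
  _◅≗_ : ∀ {A A' B} → TSAdj H A A' → TSReach≗ A' B → TSReach≗ A B
  s ◅≗ (_ , r , e) = _ , s ◅ r , e

  ≗-TSReach≗ : ∀ {A A' B} → A ≗ A' → TSReach≗ A' B → TSReach≗ A B
  ≗-TSReach≗ A≗A' (_ , ε , A'≗B) = _ , ε , λ z → trans (A≗A' z) (A'≗B z)
  ≗-TSReach≗ A≗A' (_ , s ◅ r , e) = _ , TSAdj-respˡ (λ z → sym (A≗A' z)) s ◅ r , e

  -- The move out of A is needed only for an empty path: then A ≗ B, and we go out and back.
  TSReach≗⇒TSReach : ∀ {A B C} → TSAdj H A C → TSReach≗ A B → TSReach H A B
  TSReach≗⇒TSReach s (_ , ε , A≗B) = s ◅ TSAdj-respʳ A≗B (TSAdj-sym s) ◅ ε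
  TSReach≗⇒TSReach {B = B} _ (B' , s ◅ r , B'≗B) = retarget s r
    where
    retarget : ∀ {A A'} → TSAdj H A A' → TSReach H A' B' → TSReach H A B
    retarget s ε = TSAdj-respʳ B'≗B s ◅ ε
    retarget s (s' ◅ r) = s ◅ retarget s' r

  module _ (_≟_ : DecidableEquality X) where
    infix 25 _[_↦_]
    _[_↦_] : VSet X → X → X → VSet X
    (S [ x ↦ y ]) z = (S z ∧ not ⌊ z ≟ x ⌋) ∨ ⌊ z ≟ y ⌋

    move-TSAdj : ∀ {S x y} → Independent H S → IsSingleton (λ w → w ∈ S × y ≈ w) x →
      TSAdj H S (S [ x ↦ y ])
    move-TSAdj {S} {x} {y} iS ((x∈S , yx) , only-x) =
      iS , iS' , x , y , ((x∈S , x∉S') , only-src') , ((∈-↦-new , y∉S) , only-dst') , ~-sym H yx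
      where
      ∈-↦⁺ : ∀ {z} → z ∈ S → z ≢ x → z ∈ S [ x ↦ y ]
      ∈-↦⁺ {z} z∈S z≢x = from T-∨ (inj₁ (from T-∧ (z∈S , fromWitnessFalse {a? = z ≟ x} z≢x)))
      ∈-↦-new : y ∈ S [ x ↦ y ]
      ∈-↦-new = from T-∨ (inj₂ (fromWitness {a? = y ≟ y} refl))
      ∈-↦⁻ : ∀ {z} → z ∈ S [ x ↦ y ] → (z ∈ S × z ≢ x) ⊎ z ≡ y
      ∈-↦⁻ {z} z∈ with to T-∨ z∈
      ... | inj₁ z∈S∖x = inj₁ (proj₁ (to T-∧ z∈S∖x) , toWitnessFalse {a? = z ≟ x} (proj₂ (to T-∧ z∈S∖x)))
      ... | inj₂ z≡y = inj₂ (toWitness {a? = z ≟ y} z≡y)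
      y∉S : y ∉ S
      y∉S y∈S = iS y x y∈S x∈S yx
      x∉S' : x ∉ S [ x ↦ y ]
      x∉S' x∈ with ∈-↦⁻ x∈
      ... | inj₁ (_ , x≢x) = x≢x refl
      ... | inj₂ refl = y∉S x∈S
      iS' : Independent H (S [ x ↦ y ])
      iS' a b a∈ b∈ with ∈-↦⁻ a∈ | ∈-↦⁻ b∈
      ... | inj₁ (a∈S , _) | inj₁ (b∈S , _) = iS a b a∈S b∈S
      ... | inj₁ (a∈S , a≢x) | inj₂ refl = a≢x ∘ only-x a ∘ (a∈S ,_) ∘ ~-sym H
      ... | inj₂ refl | inj₁ (b∈S , b≢x) = b≢x ∘ only-x b ∘ (b∈S ,_)
      ... | inj₂ refl | inj₂ refl = ~-irr H
      only-src' : ∀ z → z ∈ S × z ∉ S [ x ↦ y ] → z ≡ x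
      only-src' z (z∈S , z∉S') = decidable-stable (z ≟ x) (z∉S' ∘ ∈-↦⁺ z∈S)
      only-dst' : ∀ z → z ∈ S [ x ↦ y ] × z ∉ S → z ≡ y
      only-dst' z (z∈S' , z∉S) with ∈-↦⁻ z∈S'
      ... | inj₁ (z∈S , _) = ⊥-elim (z∉S z∈S)
      ... | inj₂ z≡y = z≡y

module Contraction (G : Graph) (M : VSet (V G)) where
  open TokenSliding G
  private
    X = V G
    _≈_ = _~_ G

  MeetsAt : VSet X → X → Set
  MeetsAt S a = IsSingleton (λ z → z ∈ M × z ∈ S) a

  Avoids : VSet X → Set
  Avoids S = ∀ z → z ∈ M → z ∉ S

  data Flag : Bool → VSet X → Set where
    meets  : ∀ {S a} → MeetsAt S a → Flag true S
    avoids : ∀ {S} → Avoids S → Flag false S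

  contract[_] : Bool → VSet X → VSet (VM G M)
  contract[ b ] = contractSet G M b

  inside≢outside : ∀ {z w} → z ∈ M → w ∉ M → z ≢ w
  inside≢outside z∈M w∉M refl = w∉M z∈M

  module _ {S S' : VSet X} (s : TSAdj G S S') where
    kept-outside : src s ∈ M → ∀ {w} → w ∈ S → w ∉ M → w ∈ S'
    kept-outside src∈M w∈S w∉M = kept s w∈S (inside≢outside src∈M w∉M ∘ sym)

    gained-inside : dst s ∉ M → ∀ {w} → w ∈ M → w ∈ S' → w ∈ S
    gained-inside dst∉M w∈M w∈S' = kept (TSAdj-sym s) w∈S' (inside≢outside w∈M dst∉M)

    meetsAt-inside : ∀ {a} → MeetsAt S a → src s ∈ M → dst s ∈ M → MeetsAt S' (dst s)
    meetsAt-inside (_ , only-a) src∈M dst∈M = (dst∈M , dst∈ s) , only-dst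
      where
      only-dst : ∀ z → z ∈ M × z ∈ S' → z ≡ dst s
      only-dst z (z∈M , z∈S') with T? (S z)
      ... | no z∉S = only-src (TSAdj-sym s) z (z∈S' , z∉S)
      ... | yes z∈S = ⊥-elim (src∉ s (subst (_∈ S')
                        (trans (only-a z (z∈M , z∈S)) (sym (only-a (src s) (src∈M , src∈ s)))) z∈S'))

    meetsAt-outside : ∀ {a} → MeetsAt S a → src s ∉ M → dst s ∉ M → MeetsAt S' a
    meetsAt-outside ((a∈M , a∈S) , only-a) src∉M dst∉M =
      (a∈M , kept s a∈S (inside≢outside a∈M src∉M)) ,
      λ z (z∈M , z∈S') → only-a z (z∈M , gained-inside dst∉M z∈M z∈S')

    meetsAt-exit : ∀ {a} → MeetsAt S a → src s ∈ M → dst s ∉ M → Avoids S'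
    meetsAt-exit (_ , only-a) src∈M dst∉M z z∈M z∈S' =
      src∉ s (subst (_∈ S') (trans (only-a z (z∈M , z∈S)) (sym (only-a (src s) (src∈M , src∈ s)))) z∈S')
      where z∈S = gained-inside dst∉M z∈M z∈S'

    avoids-enter : Avoids S → dst s ∈ M → MeetsAt S' (dst s)
    avoids-enter av dst∈M = (dst∈M , dst∈ s) , only-dst
      where
      only-dst : ∀ z → z ∈ M × z ∈ S' → z ≡ dst s
      only-dst z (z∈M , z∈S') with T? (S z)
      ... | no z∉S = only-src (TSAdj-sym s) z (z∈S' , z∉S)
      ... | yes z∈S = ⊥-elim (av z z∈M z∈S)

    avoids-outside : Avoids S → dst s ∉ M → Avoids S'
    avoids-outside av dst∉M z z∈M z∈S' = av z z∈M (gained-inside dst∉M z∈M z∈S')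

  project : X → VM G M
  project z with T? (M z)
  ... | yes _ = nothing
  ... | no z∉M = just (z , T-not⁺ z∉M)

  data Projects (z : X) : VM G M → Set where
    inside  : z ∈ M → Projects z nothing
    outside : (p : T (not (M z))) → Projects z (just (z , p))

  projects : ∀ z → Projects z (project z)
  projects z with T? (M z)
  ... | yes z∈M = inside z∈M
  ... | no z∉M = outside (T-not⁺ z∉M)

  project-∈ : ∀ {z} → z ∈ M → project z ≡ nothing
  project-∈ {z} z∈M with project z | projects z
  ... | _ | inside _ = refl
  ... | _ | outside z∉M = ⊥-elim (T-not⁻ z∉M z∈M)

  project-∉ : ∀ {z} (z∉M : T (not (M z))) → project z ≡ just (z , z∉M)
  project-∉ {z} z∉M with project z | projects z
  ... | _ | inside z∈M = ⊥-elim (T-not⁻ z∉M z∈M)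
  ... | _ | outside p = cong (λ q → just (z , q)) (T-irrelevant p z∉M)

  project-≢ : ∀ {x y} → x ≢ y → ¬ (x ∈ M × y ∈ M) → project x ≢ project y
  project-≢ {x} {y} x≢y ¬both with project x | projects x | project y | projects y
  ... | _ | inside x∈M | _ | inside y∈M = λ _ → ¬both (x∈M , y∈M)
  ... | _ | inside _ | _ | outside _ = λ ()
  ... | _ | outside _ | _ | inside _ = λ ()
  ... | _ | outside _ | _ | outside _ = λ { refl → x≢y refl }

  project-adj : ∀ {x y} → x ≈ y → project x ≢ project y → _~_ (contract G M) (project x) (project y)
  project-adj {x} {y} xy with project x | projects x | project y | projects y
  ... | _ | inside _ | _ | inside _ = λ ne → ne refl
  ... | _ | inside x∈M | _ | outside _ = λ _ → x , x∈M , xy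
  ... | _ | outside _ | _ | inside y∈M = λ _ → y , y∈M , xy
  ... | _ | outside _ | _ | outside _ = λ _ → xy

  project-injective-on : ∀ {b S} → Flag b S → ∀ {w w'} → w ∈ S → w' ∈ S → project w ≡ project w' → w ≡ w'
  project-injective-on f {w} {w'} w∈S w'∈S with project w | projects w | project w' | projects w' | f
  ... | _ | inside w∈M | _ | inside w'∈M | meets (_ , only) =
    λ _ → trans (only w (w∈M , w∈S)) (sym (only w' (w'∈M , w'∈S)))
  ... | _ | inside w∈M | _ | inside _ | avoids av = ⊥-elim (av w w∈M w∈S)
  ... | _ | inside _ | _ | outside _ | _ = λ ()
  ... | _ | outside _ | _ | inside _ | _ = λ ()
  ... | _ | outside _ | _ | outside _ | _ = λ { refl → refl }

  ∈-contract⁺ : ∀ {b S w} → Flag b S → w ∈ S → project w ∈ contract[ b ] S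
  ∈-contract⁺ {w = w} f w∈S with project w | projects w | f
  ... | _ | inside _ | meets _ = tt
  ... | _ | inside w∈M | avoids av = av w w∈M w∈S
  ... | _ | outside _ | _ = w∈S

  ∈-contract⁻ : ∀ {b S p} → Flag b S → p ∈ contract[ b ] S → Σ[ w ∈ X ] w ∈ S × project w ≡ p
  ∈-contract⁻ {p = nothing} (meets ((a∈M , a∈S) , _)) _ = _ , a∈S , project-∈ a∈M
  ∈-contract⁻ {p = just (x , x∉M)} _ x∈S = x , x∈S , project-∉ x∉M

  contract-≗ : ∀ {b b' S} → Flag b S → Flag b' S → contract[ b ] S ≗ contract[ b' ] S
  contract-≗ (meets _) (meets _) _ = refl
  contract-≗ (avoids _) (avoids _) _ = refl
  contract-≗ (meets ((a∈M , a∈S) , _)) (avoids av) _ = ⊥-elim (av _ a∈M a∈S)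
  contract-≗ (avoids av) (meets ((a∈M , a∈S) , _)) _ = ⊥-elim (av _ a∈M a∈S)

  contract-leaves : ∀ {b b' S S'} → Flag b S → Flag b' S' → (s : TSAdj G S S') →
    project (src s) ≢ project (dst s) →
    IsSingleton (λ p → p ∈ contract[ b ] S × p ∉ contract[ b' ] S') (project (src s))
  contract-leaves {b} {b'} {S} {S'} f f' s ne = (∈-contract⁺ f (src∈ s) , src∉') , only
    where
    src∉' : project (src s) ∉ contract[ b' ] S'
    src∉' p∈ with ∈-contract⁻ {p = project (src s)} f' p∈
    ... | w , w∈S' , pw≡ps = src∉ s (subst (_∈ S') (project-injective-on f w∈S (src∈ s) pw≡ps) w∈S')
      where
      w∈S : w ∈ S
      w∈S = kept (TSAdj-sym s) w∈S' (λ w≡dst → ne (trans (sym pw≡ps) (cong project w≡dst)))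
    only : ∀ p → p ∈ contract[ b ] S × p ∉ contract[ b' ] S' → p ≡ project (src s)
    only p (p∈ , p∉) with ∈-contract⁻ {p = p} f p∈
    ... | w , w∈S , refl = cong project (only-src s w (w∈S , p∉ ∘ ∈-contract⁺ f'))

  contract-inside : ∀ {b b' S S'} → Flag b S → Flag b' S' → (s : TSAdj G S S') →
    src s ∈ M → dst s ∈ M → contract[ b ] S ≗ contract[ b' ] S'
  contract-inside (avoids av) _ s src∈M _ _ = ⊥-elim (av _ src∈M (src∈ s))
  contract-inside _ (avoids av) s _ dst∈M _ = ⊥-elim (av _ dst∈M (dst∈ s))
  contract-inside (meets _) (meets _) s _ _ nothing = refl
  contract-inside (meets _) (meets _) s src∈M dst∈M (just (z , z∉M)) =
    TSAdj-agree s (inside≢outside src∈M (T-not⁻ z∉M) ∘ sym) (inside≢outside dst∈M (T-not⁻ z∉M) ∘ sym)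

module Lift (G : Graph) (M : VSet (V G)) (_≟_ : DecidableEquality (V G)) {v : V G} (v∈M : v ∈ M) where
  open TokenSliding
  open Contraction G M
  private
    X = V G
    G/M = contract G M

  -- The vertices of G outside M together with v induce a copy of G/M.
  low : VM G M → X
  low nothing = v
  low (just (x , _)) = x

  Representative : VSet X
  Representative z = not (M z) ∨ ⌊ z ≟ v ⌋

  lift : VSet (VM G M) → VSet X
  lift T₀ z = T₀ (project z) ∧ Representative z

  representative⁺ : ∀ {z} → (z ∈ M → z ≡ v) → z ∈ Representative
  representative⁺ {z} z∈M⇒z≡v with T? (M z)
  ... | yes z∈M = from T-∨ (inj₂ (fromWitness {a? = z ≟ v} (z∈M⇒z≡v z∈M)))
  ... | no z∉M = from T-∨ (inj₁ (T-not⁺ z∉M))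

  representative⁻ : ∀ {z} → z ∈ Representative → z ∈ M → z ≡ v
  representative⁻ {z} r z∈M with to T-∨ r
  ... | inj₁ z∉M = ⊥-elim (T-not⁻ z∉M z∈M)
  ... | inj₂ z≡v = toWitness {a? = z ≟ v} z≡v

  project-low : ∀ p → project (low p) ≡ p
  project-low nothing = project-∈ v∈M
  project-low (just (x , x∉M)) = project-∉ x∉M

  low-project : ∀ {z} → z ∈ Representative → low (project z) ≡ z
  low-project {z} r with project z | projects z
  ... | _ | inside z∈M = sym (representative⁻ r z∈M)
  ... | _ | outside _ = refl

  low-representative : ∀ p → low p ∈ Representative
  low-representative nothing = representative⁺ (λ _ → refl)
  low-representative (just (x , x∉M)) = representative⁺ (⊥-elim ∘ T-not⁻ x∉M)

  low∈lift : ∀ {T₀ p} → p ∈ T₀ → low p ∈ lift T₀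
  low∈lift {T₀} {p} p∈ = from T-∧ (subst (_∈ T₀) (sym (project-low p)) p∈ , low-representative p)

  lift-indep : ∀ {T₀} → Independent G/M T₀ → Independent G (lift T₀)
  lift-indep {T₀} iT a b a∈ b∈ ab =
    iT (project a) (project b) (proj₁ (to T-∧ a∈)) (proj₁ (to T-∧ b∈)) (project-adj ab project-a≢b)
    where
    project-a≢b : project a ≢ project b
    project-a≢b pa≡pb = ~-irr G (subst (_~_ G a) (sym a≡b) ab)
      where
      a≡b = trans (sym (low-project (proj₂ (to T-∧ a∈)))) (trans (cong low pa≡pb) (low-project (proj₂ (to T-∧ b∈))))

  lift-leaves : ∀ {T₀ T₁} (t : TSAdj G/M T₀ T₁) →
    IsSingleton (λ z → z ∈ lift T₀ × z ∉ lift T₁) (low (src G/M t))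
  lift-leaves {T₀} {T₁} t = (low∈lift {T₀} {src G/M t} (src∈ G/M t) , low∉) , only
    where
    low∉ : low (src G/M t) ∉ lift T₁
    low∉ l∈ = src∉ G/M t (subst (_∈ T₁) (project-low _) (proj₁ (to T-∧ l∈)))
    only : ∀ z → z ∈ lift T₀ × z ∉ lift T₁ → z ≡ low (src G/M t)
    only z (z∈ , z∉) = trans (sym (low-project r)) (cong low (only-src G/M t (project z) (pz∈ , pz∉)))
      where
      pz∈ = proj₁ (to T-∧ z∈)
      r = proj₂ (to T-∧ z∈)
      pz∉ : project z ∉ T₁
      pz∉ pz∈₁ = z∉ (from T-∧ (pz∈₁ , r))

  lift-contract : ∀ {b S} → Flag b S → (∀ z → z ∈ M → z ∈ S → z ≡ v) → lift (contract[ b ] S) ≗ S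
  lift-contract {b} {S} f S∩M⊆v z = T-injective to-S from-S
    where
    rep : ∀ {w} → w ∈ S → w ∈ Representative
    rep {w} w∈S = representative⁺ (λ w∈M → S∩M⊆v w w∈M w∈S)
    to-S : z ∈ lift (contract[ b ] S) → z ∈ S
    to-S z∈ with ∈-contract⁻ {p = project z} f (proj₁ (to T-∧ z∈))
    ... | w , w∈S , pw≡pz = subst (_∈ S) w≡z w∈S
      where
      w≡z = trans (sym (low-project (rep w∈S))) (trans (cong low pw≡pz) (low-project (proj₂ (to T-∧ z∈))))
    from-S : z ∈ S → z ∈ lift (contract[ b ] S)
    from-S z∈S = from T-∧ (∈-contract⁺ f z∈S , rep z∈S)

module ModuleContraction (G : Graph) (M : VSet (V G)) (isModule : IsModule G M) where
  open TokenSliding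
  open Contraction G M
  private
    X = V G
    _≈_ = _~_ G
    G/M = contract G M

  module-adj : ∀ {z x y} → z ∉ M → x ∈ M → y ∈ M → z ≈ x → z ≈ y
  module-adj {z} z∉M x∈M y∈M zx with isModule z z∉M
  ... | inj₁ adj-all = adj-all _ y∈M
  ... | inj₂ adj-none = ⊥-elim (adj-none _ x∈M zx)

  project-adj⁻ : ∀ {x y} → _~_ G/M (project x) (project y) → x ≈ y
  project-adj⁻ {x} {y} with project x | projects x | project y | projects y
  ... | _ | inside _ | _ | inside _ = λ ()
  ... | _ | inside x∈M | _ | outside y∉M =
    λ (z , z∈M , zy) → ~-sym G (module-adj (T-not⁻ y∉M) z∈M x∈M (~-sym G zy))
  ... | _ | outside x∉M | _ | inside y∈M = λ (z , z∈M , xz) → module-adj (T-not⁻ x∉M) z∈M y∈M xz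
  ... | _ | outside _ | _ | outside _ = λ xy → xy

  contract-indep : ∀ {b S} → Flag b S → Independent G S → Independent G/M (contract[ b ] S)
  contract-indep f iS p q p∈ q∈ with ∈-contract⁻ {p = p} f p∈ | ∈-contract⁻ {p = q} f q∈
  ... | w , w∈S , refl | w' , w'∈S , refl = iS w w' w∈S w'∈S ∘ project-adj⁻

  contract-TSAdj : ∀ {b b' S S'} → Flag b S → Flag b' S' → (s : TSAdj G S S') →
    project (src G s) ≢ project (dst G s) → TSAdj G/M (contract[ b ] S) (contract[ b' ] S')
  contract-TSAdj f f' s ne =
    contract-indep f (proj₁ s) , contract-indep f' (proj₁ (proj₂ s)) ,
    project (src G s) , project (dst G s) ,
    contract-leaves f f' s ne , contract-leaves f' f (TSAdj-sym G s) (ne ∘ sym) ,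
    project-adj (src~dst G s) ne

  meetsAt-no-entry : ∀ {S S' a} (s : TSAdj G S S') → MeetsAt S a → src G s ∉ M → dst G s ∈ M → ⊥
  meetsAt-no-entry s ((a∈M , a∈S) , _) src∉M dst∈M =
    proj₁ s (src G s) _ (src∈ G s) a∈S (module-adj src∉M dst∈M a∈M (src~dst G s))

  flag-step : ∀ {b S S'} → (s : TSAdj G S S') → Flag b S → Σ[ b' ∈ Bool ] Flag b' S'
  flag-step s f with T? (M (src G s)) | T? (M (dst G s)) | f
  ... | _ | yes dst∈M | avoids av = true , meets (avoids-enter s av dst∈M)
  ... | _ | no dst∉M | avoids av = false , avoids (avoids-outside s av dst∉M)
  ... | yes src∈M | yes dst∈M | meets m = true , meets (meetsAt-inside s m src∈M dst∈M)
  ... | yes src∈M | no dst∉M | meets m = false , avoids (meetsAt-exit s m src∈M dst∉M)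
  ... | no src∉M | yes dst∈M | meets m = ⊥-elim (meetsAt-no-entry s m src∉M dst∈M)
  ... | no src∉M | no dst∉M | meets m = true , meets (meetsAt-outside s m src∉M dst∉M)

  contract-step : ∀ {b b' S S'} → Flag b S → Flag b' S' → (s : TSAdj G S S') →
    TSAdj G/M (contract[ b ] S) (contract[ b' ] S') ⊎ contract[ b ] S ≗ contract[ b' ] S'
  contract-step f f' s with T? (M (src G s)) ×-dec T? (M (dst G s))
  ... | yes (src∈M , dst∈M) = inj₂ (contract-inside f f' s src∈M dst∈M)
  ... | no ¬both = inj₁ (contract-TSAdj f f' s (project-≢ (src≢dst G s) ¬both))

  contract-TSReach≗ : ∀ {b b' S S'} → Flag b S → Flag b' S' → TSReach G S S' →
    TSReach≗ G/M (contract[ b ] S) (contract[ b' ] S')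
  contract-TSReach≗ f f' ε = _ , ε , contract-≗ f f'
  contract-TSReach≗ f f' (s ◅ r) with flag-step s f
  ... | _ , f₁ with contract-step f f₁ s
  ...   | inj₁ t = _◅≗_ G/M t (contract-TSReach≗ f₁ f' r)
  ...   | inj₂ e = ≗-TSReach≗ G/M e (contract-TSReach≗ f₁ f' r)

  module _ (_≟_ : DecidableEquality X) {v} (v∈M : v ∈ M) where
    open Lift G M _≟_ v∈M

    low-adj : ∀ {p q} → _~_ G/M p q → low p ≈ low q
    low-adj {p} {q} pq = project-adj⁻ (subst₂ (_~_ G/M) (sym (project-low p)) (sym (project-low q)) pq)

    lift-TSAdj : ∀ {T₀ T₁} → TSAdj G/M T₀ T₁ → TSAdj G (lift T₀) (lift T₁)
    lift-TSAdj t =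
      lift-indep (proj₁ t) , lift-indep (proj₁ (proj₂ t)) ,
      low (src G/M t) , low (dst G/M t) ,
      lift-leaves t , lift-leaves (TSAdj-sym G/M t) ,
      low-adj {src G/M t} {dst G/M t} (src~dst G/M t)

  TSReach-contract⇔ : DecidableEquality X → ∀ {S S' S₁ u v} → MeetsAt S u → MeetsAt S' v →
    (s : TSAdj G S S₁) → Avoids S₁ →
    TSReach G S S' ⇔ TSReach G/M (contract[ true ] S) (contract[ true ] S')
  TSReach-contract⇔ _≟_ {S} {S'} {S₁} S∩M≡u S'∩M≡v@((v∈M , _) , only-v) s S₁∩M≡∅ = mk⇔ forward backward
    where
    open Lift G M _≟_ v∈M
    exit : TSAdj G/M (contract[ true ] S) (contract[ false ] S₁)
    exit = contract-TSAdj (meets S∩M≡u) (avoids S₁∩M≡∅) s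
             (project-≢ (src≢dst G s) (λ (_ , dst∈M) → S₁∩M≡∅ _ dst∈M (dst∈ G s)))
    forward : TSReach G S S' → TSReach G/M (contract[ true ] S) (contract[ true ] S')
    forward r = TSReach≗⇒TSReach G/M exit (contract-TSReach≗ (meets S∩M≡u) (meets S'∩M≡v) r)
    S₁≗lift : S₁ ≗ lift (contract[ false ] S₁)
    S₁≗lift z = sym (lift-contract (avoids S₁∩M≡∅) (λ w w∈M w∈S₁ → ⊥-elim (S₁∩M≡∅ w w∈M w∈S₁)) z)
    lift≗S' : lift (contract[ true ] S') ≗ S'
    lift≗S' = lift-contract (meets S'∩M≡v) (λ z z∈M z∈S' → only-v z (z∈M , z∈S'))
    backward : TSReach G/M (contract[ true ] S) (contract[ true ] S') → TSReach G S S'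
    backward r = TSReach≗⇒TSReach G s (_◅≗_ G s (≗-TSReach≗ G S₁≗lift
      (_ , gmap lift (lift-TSAdj _≟_ v∈M) (TSAdj-sym G/M exit ◅ r) , lift≗S')))

module Confinement (G : Graph) (M : VSet (V G)) (isModule : IsModule G M) where
  open Forks G
  open TokenSliding G
  open Contraction G M
  open ModuleContraction G M isModule using (module-adj; meetsAt-no-entry)
  private
    X = V G
    _≈_ = _~_ G

  -- Classically: x has a neighbour in S ∖ M.
  SeesOutside : VSet X → X → Set
  SeesOutside S x = ¬ (∀ w → w ∈ S → w ∉ M → ¬ x ≈ w)

  Confined : X → VSet X → Set
  Confined u S = Σ[ a ∈ X ] MeetsAt S a × ConnectedIn G M u a × (∀ x → x ∉ M → x ≈ a → SeesOutside S x)

  confined-start : ∀ {u I} → MeetsAt I u →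
    ¬ (Σ[ c ∈ X ] (c ∉ M × IsSingleton (λ z → z ∈ I × c ≈ z) u)) → Confined u I
  confined-start {u} {I} I∩M≡u@((_ , u∈I) , only-u) no-c = u , I∩M≡u , ε , sees
    where
    sees : ∀ x → x ∉ M → x ≈ u → SeesOutside I x
    sees x x∉M xu no-outside = no-c (x , x∉M , (u∈I , xu) , only)
      where
      only : ∀ z → z ∈ I × x ≈ z → z ≡ u
      only z (z∈I , xz) with T? (M z)
      ... | yes z∈M = only-u z (z∈M , z∈I)
      ... | no z∉M = ⊥-elim (no-outside z z∈I z∉M xz)

  -- A vertex x seeing a and src s but not dst s would be the centre of a fork with leaves a, v, src s.
  seesOutside-step : ForkFree G → ∀ {v a x S S'} → v ∈ M → a ≢ v → ¬ a ≈ v →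
    (s : TSAdj G S S') → MeetsAt S a → src s ∉ M → dst s ∉ M →
    x ∉ M → x ≈ a → SeesOutside S x → SeesOutside S' x
  seesOutside-step forkFree {v} {a} {x} {S} {S'} v∈M a≢v ¬a~v s S∩M≡a@((a∈M , a∈S) , _) src∉M dst∉M
    x∉M xa sees none' = sees none
    where
    a∈S' : a ∈ S'
    a∈S' = proj₂ (proj₁ (meetsAt-outside s S∩M≡a src∉M dst∉M))
    ¬v~ : ∀ {w} → ¬ a ≈ w → w ∉ M → ¬ v ≈ w
    ¬v~ ¬aw w∉M vw = ¬aw (~-sym G (module-adj w∉M v∈M a∈M (~-sym G vw)))
    ¬a~src : ¬ a ≈ src s
    ¬a~src = proj₁ s a (src s) a∈S (src∈ s)
    ¬a~dst : ¬ a ≈ dst s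
    ¬a~dst = proj₁ (proj₂ s) a (dst s) a∈S' (dst∈ s)
    fork : x ≈ src s → ⊥
    fork x~src = no-fork forkFree a≢v xa (module-adj x∉M a∈M v∈M xa) x~src (src~dst s)
      ¬a~v ¬a~src (¬v~ ¬a~src src∉M) (none' (dst s) (dst∈ s) dst∉M) ¬a~dst (¬v~ ¬a~dst dst∉M)
    none : ∀ w → w ∈ S → w ∉ M → ¬ x ≈ w
    none w w∈S w∉M xw with T? (S' w)
    ... | yes w∈S' = none' w w∈S' w∉M xw
    ... | no w∉S' = fork (subst (x ≈_) (only-src s w (w∈S , w∉S')) xw)

  confined-step : ForkFree G → ∀ {u v} → v ∈ M → ¬ ConnectedIn G M u v →
    ∀ {S S'} → TSAdj G S S' → Confined u S → Confined u S'
  confined-step forkFree {u} {v} v∈M u↮v {S' = S'} s (a , S∩M≡a@((a∈M , _) , only-a) , u→a , blocked)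
    with T? (M (src s)) | T? (M (dst s))
  ... | yes src∈M | yes dst∈M =
    dst s , meetsAt-inside s S∩M≡a src∈M dst∈M , u→a ◅◅ ((a∈M , dst∈M , a~dst) ◅ ε) , blocked'
    where
    a~dst : a ≈ dst s
    a~dst = subst (_≈ dst s) (only-a _ (src∈M , src∈ s)) (src~dst s)
    blocked' : ∀ x → x ∉ M → x ≈ dst s → SeesOutside S' x
    blocked' x x∉M x~dst none' = blocked x x∉M (module-adj x∉M dst∈M a∈M x~dst)
      (λ w w∈S w∉M → none' w (kept-outside s src∈M w∈S w∉M) w∉M)
  ... | yes src∈M | no dst∉M = ⊥-elim (blocked (dst s) dst∉M dst~a
      (λ w w∈S w∉M → proj₁ (proj₂ s) (dst s) w (dst∈ s) (kept-outside s src∈M w∈S w∉M)))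
    where
    dst~a : dst s ≈ a
    dst~a = subst (dst s ≈_) (only-a _ (src∈M , src∈ s)) (~-sym G (src~dst s))
  ... | no src∉M | yes dst∈M = ⊥-elim (meetsAt-no-entry s S∩M≡a src∉M dst∈M)
  ... | no src∉M | no dst∉M =
    a , meetsAt-outside s S∩M≡a src∉M dst∉M , u→a ,
    λ x x∉M xa → seesOutside-step forkFree v∈M a≢v ¬a~v s S∩M≡a src∉M dst∉M x∉M xa (blocked x x∉M xa)
    where
    a≢v : a ≢ v
    a≢v a≡v = u↮v (subst (ConnectedIn G M u) a≡v u→a)
    ¬a~v : ¬ a ≈ v
    ¬a~v av = u↮v (u→a ◅◅ ((a∈M , v∈M , av) ◅ ε))

  confined-reach : ForkFree G → ∀ {u v} → v ∈ M → ¬ ConnectedIn G M u v →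
    ∀ {S S'} → TSReach G S S' → Confined u S → Confined u S'
  confined-reach _ _ _ ε c = c
  confined-reach forkFree v∈M u↮v (s ◅ r) c =
    confined-reach forkFree v∈M u↮v r (confined-step forkFree v∈M u↮v s c)

  confined-meets : ∀ {u v S} → Confined u S → MeetsAt S v → ConnectedIn G M u v
  confined-meets {u} (a , ((a∈M , a∈S) , _) , u→a , _) (_ , only-v) =
    subst (ConnectedIn G M u) (only-v a (a∈M , a∈S)) u→a

lemma6p3 : (G : Graph) → Finite G → ForkFree G →
    (I J : VSet (V G)) → Independent G I → Independent G J → SameSize I J →
    NoVertexSeesThree G I →
    (M : VSet (V G)) → IsModule G M → NonTrivial G M →
    (u v : V G) →
    IsSingleton (λ z → z ∈ M × z ∈ I) u →
    IsSingleton (λ z → z ∈ M × z ∈ J) v →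
    ¬ ConnectedIn G M u v →
    ((Σ[ c ∈ V G ] (c ∉ M × IsSingleton (λ z → z ∈ I × _~_ G c z) u)) →
    (TSReach G I J ⇔ TSReach (contract G M) (contractSet G M true I) (contractSet G M true J)))
    ×
    (¬ (Σ[ c ∈ V G ] (c ∉ M × IsSingleton (λ z → z ∈ I × _~_ G c z) u)) →
    ¬ TSReach G I J)
lemma6p3 G (_ , V↔Fin) forkFree I J iI _ _ _ M isModule _ u v I∩M≡u J∩M≡v u↮v = reduce , blocked
  where
  open TokenSliding G
  open Contraction G M
  open ModuleContraction G M isModule
  open Confinement G M isModule
  _≟_ : DecidableEquality (V G)
  _≟_ = inj⇒≟ (↔⇒↣ V↔Fin)
  reduce : Σ[ c ∈ V G ] (c ∉ M × IsSingleton (λ z → z ∈ I × _~_ G c z) u) →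
    TSReach G I J ⇔ TSReach (contract G M) (contract[ true ] I) (contract[ true ] J)
  reduce (c , c∉M , N[c]∩I≡u) = TSReach-contract⇔ _≟_ I∩M≡u J∩M≡v exit (meetsAt-exit exit I∩M≡u u∈M c∉M)
    where
    u∈M = proj₁ (proj₁ I∩M≡u)
    exit = move-TSAdj _≟_ iI N[c]∩I≡u
  blocked : ¬ (Σ[ c ∈ V G ] (c ∉ M × IsSingleton (λ z → z ∈ I × _~_ G c z) u)) → ¬ TSReach G I J
  blocked no-c r = u↮v (confined-meets (confined-reach forkFree v∈M u↮v r (confined-start I∩M≡u no-c)) J∩M≡v)
    where
    v∈M = proj₁ (proj₁ J∩M≡v)
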